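{- In the execution of $\textsc{Move-Half}$ on any request sequence, whenever an item $v$ is moved down to depth $h$ in $\textsc{Move-Half}$'s tree, at that time the depth of $v$ in an MRU tree is at least $\lfloor h/2\rfloor$ (equivalently, $v.\mathrm{rank}\ge 2^{\lfloor h/2\rfloor}$).
   Context: Self-adjusting complete tree model: a set $V$ of $n$ items is stored in a complete binary tree of $n$ servers, one item per server; the root has depth $0$ and an item's depth is that of its hosting server; level $d$ contains $2^d$ servers. The rank of item $v$ at time $t$ is the number of distinct items requested since the last request of $v$ before $t$, including $v$. In an MRU tree every item $v$ has depth $\lfloor\log_2 v.\mathrm{rank}\rfloor$. Algorithm $\textsc{Move-Half}$: starting from an MRU tree, upon a request to item $u$ at depth $d$ it accesses $u$, lets $v$ be the item of highest rank among the items at depth $\lfloor d/2\rfloor$, and interchanges the positions of $u$ and $v$ (all other items stay in place). Thus items move down only as the item $v$ of such an interchange. -}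

module Defs where

open import Data.Nat using (ℕ; suc; _≤_; _<_; _^_; ⌊_/2⌋)
open import Data.Nat.Logarithm using (⌊log₂_⌋)
open import Data.Fin using (Fin; toℕ)
open import Data.Fin.Properties using (_≟_)
open import Data.List using (List; _∷_; length; takeWhile; deduplicate)
open import Data.List.Membership.Propositional using (_∈_)
open import Data.Product using (_×_)
open import Function using (_∘_)
open import Function.Definitions using (Injective)
open import Relation.Binary.PropositionalEquality using (_≡_)
open import Relation.Nullary using (¬?; yes; no)

-- Servers are Fin n, in heap order: server i sits at heap position i+1,
-- so its depth is ⌊log₂ (i+1)⌋ (root depth 0, level d holds 2^d servers).
depth : ∀ {n} → Fin n → ℕ
depth i = ⌊log₂ suc (toℕ i) ⌋

-- A request history, most recent request first.
History : ℕ → Set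
History n = List (Fin n)

-- rank of v: number of distinct items requested since (and including)
-- the last request of v.
rank : ∀ {n} → Fin n → History n → ℕ
rank v hist = suc (length (deduplicate _≟_ (takeWhile (λ x → ¬? (x ≟ v)) hist)))

Covers : ∀ {n} → History n → Set
Covers {n} hist = (v : Fin n) → v ∈ hist

-- Placement: item ↦ hosting server.
Placement : ℕ → Set
Placement n = Fin n → Fin n

IsMRU : ∀ {n} → Placement n → History n → Set
IsMRU {n} pos hist = (v : Fin n) → depth (pos v) ≡ ⌊log₂ rank v hist ⌋

swapPos : ∀ {n} → Placement n → Fin n → Fin n → Placement n
swapPos pos u v w with w ≟ u | w ≟ v
... | yes _ | _     = pos v
... | no _  | yes _ = pos u
... | no _  | no _  = pos w

Partner : ∀ {n} → Placement n → History n → Fin n → Fin n → Set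
Partner {n} pos hist u v =
  depth (pos v) ≡ ⌊ depth (pos u) /2⌋ ×
  ((w : Fin n) → depth (pos w) ≡ ⌊ depth (pos u) /2⌋ → rank w hist ≤ rank v hist)

data Reachable {n : ℕ} : Placement n → History n → Set where
  start : (pos : Placement n) (hist : History n) →
          Injective _≡_ _≡_ pos → Covers hist → IsMRU pos hist →
          Reachable pos hist
  step  : {pos : Placement n} {hist : History n} (u v : Fin n) →
          Reachable pos hist → Partner pos hist u v →
          Reachable (swapPos pos u v) (u ∷ hist)

module Submission where

-- Let v be moved down from depth k = ⌊d/2⌋ to the depth d > k of the requested item u.
-- A server at depth d > k exists, so level k is full: its 2^k servers host (pos is a
-- bijection) 2^k items. Ranks of distinct items are distinct, since the one requested
-- more recently has every item of the other's window in its own, plus itself. Hence the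
-- 2^k items of level k have distinct ranks, all at most rank v, and rank v ≥ 2^k.

open import Defs
open import Data.Nat using (ℕ; zero; suc; pred; _+_; _*_; _∸_; _^_; ⌊_/2⌋; _≤_; _<_; z≤n; s≤s)
open import Data.Nat.Properties hiding (_≟_)
open import Data.Nat.Logarithm using (⌊log₂_⌋; ⌊log₂⌋-mono-≤; ⌊log₂⌊n/2⌋⌋≡⌊log₂n⌋∸1; ⌊log₂[2^n]⌋≡n)
open import Data.Fin using (Fin; toℕ; fromℕ<; punchOut)
open import Data.Fin.Properties
  using (_≟_; toℕ-injective; toℕ-fromℕ<; fromℕ<-injective; punchOut-injective; injective⇒≤; any?; toℕ<n)
open import Data.Fin.Permutation.Components using (transpose; transpose-inverse)
open import Data.List using (List; _∷_; length; takeWhile; deduplicate)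
open import Data.List.Properties using (length-removeAt′)
open import Data.List.Relation.Unary.Any using (here; there; index; _─_)
open import Data.List.Relation.Unary.All as All using (All)
open import Data.List.Relation.Unary.AllPairs using ([]; _∷_)
open import Data.List.Relation.Unary.Unique.Propositional using (Unique)
open import Data.List.Relation.Unary.Unique.DecPropositional.Properties using (deduplicate-!)
open import Data.List.Relation.Binary.Subset.Propositional using (_⊆_)
open import Data.List.Membership.Propositional using (_∈_)
open import Data.List.Membership.Propositional.Properties using (∈-deduplicate⁺; ∈-deduplicate⁻)
open import Data.Product using (_×_; ∃; _,_; proj₁; proj₂)
open import Data.Sum using (_⊎_; inj₁; inj₂)
open import Function using (_∘_)
open import Function.Definitions using (Injective)
open import Relation.Nullary using (yes; no; ¬?; contradiction)
open import Relation.Binary.PropositionalEquality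

⌊n/2⌋<m : ∀ {n} m → n < 2 * m → ⌊ n /2⌋ < m
⌊n/2⌋<m {zero}        (suc m) _ = s≤s z≤n
⌊n/2⌋<m {suc zero}    (suc m) _ = s≤s z≤n
⌊n/2⌋<m {suc (suc n)} (suc m) n+2<2m+2 =
  s≤s (⌊n/2⌋<m m (≤-pred (≤-pred (subst (3 + n ≤_) (*-suc 2 m) n+2<2m+2))))

⌊log₂n⌋≤m : ∀ m {n} → n < 2 ^ suc m → ⌊log₂ n ⌋ ≤ m
⌊log₂n⌋≤m zero    {0}           _ = z≤n
⌊log₂n⌋≤m zero    {1}           _ = z≤n
⌊log₂n⌋≤m zero    {suc (suc _)} (s≤s (s≤s ()))
⌊log₂n⌋≤m (suc m) {n}           n<2^[2+m] = begin
  ⌊log₂ n ⌋                 ≤⟨ m≤n+m∸n ⌊log₂ n ⌋ 1 ⟩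
  suc (⌊log₂ n ⌋ ∸ 1)       ≡⟨ cong suc (⌊log₂⌊n/2⌋⌋≡⌊log₂n⌋∸1 n) ⟨
  suc ⌊log₂ ⌊ n /2⌋ ⌋       ≤⟨ s≤s (⌊log₂n⌋≤m m (⌊n/2⌋<m (2 ^ suc m) n<2^[2+m])) ⟩
  suc m                     ∎
  where open ≤-Reasoning

2^m≤n⇒m≤⌊log₂n⌋ : ∀ m {n} → 2 ^ m ≤ n → m ≤ ⌊log₂ n ⌋
2^m≤n⇒m≤⌊log₂n⌋ m 2^m≤n = subst (_≤ _) (⌊log₂[2^n]⌋≡n m) (⌊log₂⌋-mono-≤ 2^m≤n)

m<⌊log₂n⌋⇒2^[1+m]≤n : ∀ m {n} → m < ⌊log₂ n ⌋ → 2 ^ suc m ≤ n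
m<⌊log₂n⌋⇒2^[1+m]≤n m m<log = ≮⇒≥ (<⇒≱ m<log ∘ ⌊log₂n⌋≤m m)

2^m≤n<2^[1+m]⇒⌊log₂n⌋≡m : ∀ m {n} → 2 ^ m ≤ n → n < 2 ^ suc m → ⌊log₂ n ⌋ ≡ m
2^m≤n<2^[1+m]⇒⌊log₂n⌋≡m m 2^m≤n n<2^[1+m] =
  ≤-antisym (⌊log₂n⌋≤m m n<2^[1+m]) (2^m≤n⇒m≤⌊log₂n⌋ m 2^m≤n)

module _ {A : Set} where

  ∈-─ : ∀ {x y : A} {ys} (x∈ys : x ∈ ys) → y ∈ ys → y ≢ x → y ∈ (ys ─ x∈ys)
  ∈-─ (here refl) (here refl) y≢x = contradiction refl y≢x
  ∈-─ (here refl) (there y∈ys) _  = y∈ys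
  ∈-─ (there _)   (here refl)  _  = here refl
  ∈-─ (there x∈ys) (there y∈ys) y≢x = there (∈-─ x∈ys y∈ys y≢x)

  unique-⊆⇒length≤ : ∀ {xs ys : List A} → Unique xs → xs ⊆ ys → length xs ≤ length ys
  unique-⊆⇒length≤ [] _ = z≤n
  unique-⊆⇒length≤ {x ∷ xs} {ys} (x∉xs ∷ xs!) x∷xs⊆ys = begin
    suc (length xs)           ≤⟨ s≤s (unique-⊆⇒length≤ xs! xs⊆ys─x) ⟩
    suc (length (ys ─ x∈ys))  ≡⟨ length-removeAt′ ys (index x∈ys) ⟨
    length ys                 ∎
    where
    open ≤-Reasoning
    x∈ys : x ∈ ys
    x∈ys = x∷xs⊆ys (here refl)
    xs⊆ys─x : xs ⊆ (ys ─ x∈ys)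
    xs⊆ys─x y∈xs = ∈-─ x∈ys (x∷xs⊆ys (there y∈xs)) (All.lookup x∉xs y∈xs ∘ sym)

module _ {n : ℕ} where

  since : Fin n → History n → List (Fin n)
  since v = takeWhile (λ x → ¬? (x ≟ v))

  since-≢ : ∀ {y v} hist → y ∈ since v hist → y ≢ v
  since-≢ {v = v} (x ∷ hist) y∈ with x ≟ v | y∈
  ... | no x≢v | here refl = x≢v
  ... | no _   | there y∈  = since-≢ hist y∈

  since-trans : ∀ {y v w} hist → v ∈ since w hist → y ∈ since v hist → y ∈ since w hist
  since-trans {v = v} {w} (x ∷ hist) v∈ y∈ with x ≟ w | x ≟ v | v∈ | y∈
  ... | no _ | no x≢v | here refl | _         = contradiction refl x≢v
  ... | no _ | no _   | there _   | here refl = here refl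
  ... | no _ | no _   | there v∈  | there y∈  = there (since-trans hist v∈ y∈)

  since-connex : ∀ {v w} hist → v ∈ hist → v ≢ w → v ∈ since w hist ⊎ w ∈ since v hist
  since-connex {v} {w} (x ∷ hist) v∈ v≢w with x ≟ w | x ≟ v | v∈
  ... | yes refl | yes refl | _        = contradiction refl v≢w
  ... | yes refl | no _     | _        = inj₂ (here refl)
  ... | no _     | yes refl | _        = inj₁ (here refl)
  ... | no _     | no x≢v   | here refl = contradiction refl x≢v
  ... | no _     | no _     | there v∈ with since-connex hist v∈ v≢w
  ...   | inj₁ v∈′ = inj₁ (there v∈′)
  ...   | inj₂ w∈′ = inj₂ (there w∈′)

  rank-< : ∀ {v w} hist → v ∈ since w hist → rank v hist < rank w hist
  rank-< {v} {w} hist v∈ = s≤s (unique-⊆⇒length≤ (v∉ ∷ deduplicate-! _≟_ (since v hist)) ⊆since-w)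
    where
    v∉ : All (v ≢_) (deduplicate _≟_ (since v hist))
    v∉ = All.tabulate (λ y∈ → since-≢ hist (∈-deduplicate⁻ _≟_ (since v hist) y∈) ∘ sym)
    ⊆since-w : v ∷ deduplicate _≟_ (since v hist) ⊆ deduplicate _≟_ (since w hist)
    ⊆since-w (here refl) = ∈-deduplicate⁺ _≟_ v∈
    ⊆since-w (there y∈)  =
      ∈-deduplicate⁺ _≟_ (since-trans hist v∈ (∈-deduplicate⁻ _≟_ (since v hist) y∈))

  rank-injective : ∀ {hist} → Covers hist → Injective _≡_ _≡_ (λ v → rank v hist)
  rank-injective {hist} covers {v} {w} rank≡ with v ≟ w
  ... | yes v≡w = v≡w
  ... | no v≢w with since-connex hist (covers v) v≢w
  ...   | inj₁ v∈ = contradiction rank≡ (<⇒≢ (rank-< hist v∈))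
  ...   | inj₂ w∈ = contradiction (sym rank≡) (<⇒≢ (rank-< hist w∈))

injective⇒surjective : ∀ {n} {f : Fin n → Fin n} → Injective _≡_ _≡_ f → ∀ y → ∃ λ x → f x ≡ y
injective⇒surjective {f = f} f-inj y with any? (λ x → f x ≟ y)
... | yes hit = hit
injective⇒surjective {suc n} {f} f-inj y | no miss = contradiction (injective⇒≤ g-inj) (<-irrefl refl)
  where
  g : Fin (suc n) → Fin n
  g x = punchOut {i = y} (miss ∘ (x ,_) ∘ sym)
  g-inj : Injective _≡_ _≡_ g
  g-inj e = f-inj (punchOut-injective (miss ∘ (_ ,_) ∘ sym) (miss ∘ (_ ,_) ∘ sym) e)

injective-below⇒≤ : ∀ {m b} (f : Fin m → ℕ) → (∀ i → f i < b) → Injective _≡_ _≡_ f → m ≤ b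
injective-below⇒≤ f f<b f-inj =
  injective⇒≤ {f = λ i → fromℕ< (f<b i)} (f-inj ∘ fromℕ<-injective _ _ (f<b _) (f<b _))

module _ {n : ℕ} (k : ℕ) (full : 2 ^ suc k ≤ n) where

  heapPosition : Fin (2 ^ k) → ℕ
  heapPosition i = 2 ^ k + toℕ i

  heapPosition<2^[1+k] : ∀ i → heapPosition i < 2 ^ suc k
  heapPosition<2^[1+k] i = +-monoʳ-< (2 ^ k) (subst (toℕ i <_) (sym (+-identityʳ (2 ^ k))) (toℕ<n i))

  serverIndex : Fin (2 ^ k) → ℕ
  serverIndex i = pred (2 ^ k) + toℕ i

  suc-serverIndex : ∀ i → suc (serverIndex i) ≡ heapPosition i
  suc-serverIndex i = cong (_+ toℕ i) (suc-pred (2 ^ k) {{m^n≢0 2 k}})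

  levelServer : Fin (2 ^ k) → Fin n
  levelServer i = fromℕ< {serverIndex i}
    (≤-trans (subst (_≤ 2 ^ suc k) (sym (suc-serverIndex i)) (<⇒≤ (heapPosition<2^[1+k] i))) full)

  levelServer-injective : Injective _≡_ _≡_ levelServer
  levelServer-injective e = toℕ-injective (+-cancelˡ-≡ (pred (2 ^ k)) _ _ (fromℕ<-injective _ _ _ _ e))

  depth-levelServer : ∀ i → depth (levelServer i) ≡ k
  depth-levelServer i = begin
    ⌊log₂ suc (toℕ (levelServer i)) ⌋       ≡⟨ cong (⌊log₂_⌋ ∘ suc) (toℕ-fromℕ< {serverIndex i} _) ⟩
    ⌊log₂ suc (serverIndex i) ⌋             ≡⟨ cong ⌊log₂_⌋ (suc-serverIndex i) ⟩
    ⌊log₂ heapPosition i ⌋                  ≡⟨ 2^m≤n<2^[1+m]⇒⌊log₂n⌋≡m k (m≤m+n _ _) (heapPosition<2^[1+k] i) ⟩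
    k                                       ∎
    where open ≡-Reasoning

2^k≤max-rank-on-level : ∀ {n} {pos : Placement n} {hist : History n} {k r} →
  Injective _≡_ _≡_ pos → Covers hist → 2 ^ suc k ≤ n →
  (∀ w → depth (pos w) ≡ k → rank w hist ≤ r) → 2 ^ k ≤ r
2^k≤max-rank-on-level {n} {pos} {hist} {k} pos-injective covers full rank≤r =
  -- ranks are positive, so rank w ≤ r says pred (rank w) < r
  injective-below⇒≤ (pred ∘ itemRank) (λ i → rank≤r (item i) (depth-item i)) itemRank-injective
  where
  item : Fin (2 ^ k) → Fin n
  item i = proj₁ (injective⇒surjective pos-injective (levelServer k full i))
  pos-item : ∀ i → pos (item i) ≡ levelServer k full i
  pos-item i = proj₂ (injective⇒surjective pos-injective (levelServer k full i))
  depth-item : ∀ i → depth (pos (item i)) ≡ k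
  depth-item i = trans (cong depth (pos-item i)) (depth-levelServer k full i)
  itemRank : Fin (2 ^ k) → ℕ
  itemRank i = rank (item i) hist
  itemRank-injective : Injective _≡_ _≡_ (pred ∘ itemRank)
  itemRank-injective {i} {j} e = levelServer-injective k full (begin
    levelServer k full i  ≡⟨ pos-item i ⟨
    pos (item i)          ≡⟨ cong pos (rank-injective covers (cong suc e)) ⟩
    pos (item j)          ≡⟨ pos-item j ⟩
    levelServer k full j  ∎)
    where open ≡-Reasoning

swapPos≗transpose : ∀ {n} (pos : Placement n) u v w → swapPos pos u v w ≡ pos (transpose u v w)
swapPos≗transpose pos u v w with w ≟ u
... | yes _ = refl
... | no _ with w ≟ v
...   | yes _ = refl
...   | no _  = refl

swapPos-injective : ∀ {n} {pos : Placement n} u v → Injective _≡_ _≡_ pos →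
                    Injective _≡_ _≡_ (swapPos pos u v)
swapPos-injective {pos = pos} u v pos-injective {w} {w′} e = begin
  w                                   ≡⟨ transpose-inverse v u ⟨
  transpose v u (transpose u v w)     ≡⟨ cong (transpose v u) (pos-injective (begin
      pos (transpose u v w)           ≡⟨ swapPos≗transpose pos u v w ⟨
      swapPos pos u v w               ≡⟨ e ⟩
      swapPos pos u v w′              ≡⟨ swapPos≗transpose pos u v w′ ⟩
      pos (transpose u v w′)          ∎)) ⟩
  transpose v u (transpose u v w′)    ≡⟨ transpose-inverse v u ⟩
  w′                                  ∎
  where open ≡-Reasoning

swapPos[v]≡pos[u] : ∀ {n} (pos : Placement n) u v → swapPos pos u v v ≡ pos u
swapPos[v]≡pos[u] pos u v with v ≟ u | v ≟ v
... | yes refl | _       = refl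
... | no _     | yes _   = refl
... | no _     | no v≢v  = contradiction refl v≢v

Reachable⇒injective : ∀ {n} {pos : Placement n} {hist} → Reachable pos hist → Injective _≡_ _≡_ pos
Reachable⇒injective (start _ _ pos-injective _ _) = pos-injective
Reachable⇒injective (step u v reachable _)        = swapPos-injective u v (Reachable⇒injective reachable)

Reachable⇒covers : ∀ {n} {pos : Placement n} {hist} → Reachable pos hist → Covers hist
Reachable⇒covers (start _ _ _ covers _)  = covers
Reachable⇒covers (step u _ reachable _)  = there ∘ Reachable⇒covers reachable

lemma1 : ∀ {n} (pos : Placement n) (hist : History n) (u v : Fin n) →
         Reachable pos hist → Partner pos hist u v →
         depth (pos v) < depth (swapPos pos u v v) →
         ⌊ depth (swapPos pos u v v) /2⌋ ≤ ⌊log₂ rank v hist ⌋ ×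
         2 ^ ⌊ depth (swapPos pos u v v) /2⌋ ≤ rank v hist
lemma1 {n} pos hist u v reachable (v-on-level , v-best) moved-down
  with swapPos pos u v v | swapPos[v]≡pos[u] pos u v
... | _ | refl = 2^m≤n⇒m≤⌊log₂n⌋ k 2^k≤rank , 2^k≤rank
  where
  k : ℕ
  k = ⌊ depth (pos u) /2⌋
  level-full : 2 ^ suc k ≤ n
  level-full = ≤-trans (m<⌊log₂n⌋⇒2^[1+m]≤n k (subst (_< _) v-on-level moved-down)) (toℕ<n (pos u))
  2^k≤rank : 2 ^ k ≤ rank v hist
  2^k≤rank = 2^k≤max-rank-on-level (Reachable⇒injective reachable) (Reachable⇒covers reachable)
               level-full v-best
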